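{- For every positive integer $t$ and every $n\geq 2$, $\operatorname{im}(K_t\,\Box\, P_n)=t+1$.
   Context: All graphs are finite and simple. $K_t$ is the complete graph on $t$ vertices and $P_n$ the path on $n$ vertices. A graph $G$ has a $G'$-immersion if there is an injective map $\phi:V(G')\to V(G)$ such that for every edge $uv\in E(G')$ there is a path in $G$ joining $\phi(u)$ and $\phi(v)$, and these paths are pairwise edge-disjoint. The immersion number $\operatorname{im}(G)$ is the largest $t$ such that $G$ has a $K_t$-immersion. The Cartesian product $G\,\Box\, H$ has vertex set $V(G)\times V(H)$, with $(g,h)$ adjacent to $(g',h')$ iff $g=g'$ and $hh'\in E(H)$, or $gg'\in E(G)$ and $h=h'$. -}

module Defs where

open import Level using (0ℓ)
open import Data.Nat using (ℕ; zero; suc; _≤_)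
open import Data.Fin using (Fin; toℕ) renaming (_<_ to _<ᶠ_)
open import Data.Product using (Σ; _×_; _,_)
open import Data.Sum using (_⊎_; inj₁; inj₂)
open import Data.List using (List; []; _∷_)
open import Data.List.Membership.Propositional using (_∈_)
open import Data.List.Relation.Unary.AllPairs using (AllPairs)
open import Function.Definitions using (Injective)
open import Relation.Nullary using (¬_)
open import Relation.Binary.PropositionalEquality using (_≡_; _≢_; refl; sym)

record Graph : Set₁ where
  field
    V      : Set
    Adj    : V → V → Set
    symAdj : ∀ {u v} → Adj u v → Adj v u
    irrAdj : ∀ {u} → ¬ Adj u u
open Graph public

K : ℕ → Graph
K t = record
  { V = Fin t
  ; Adj = λ a b → a ≢ b
  ; symAdj = λ a≢b b≡a → a≢b (sym b≡a)
  ; irrAdj = λ a≢a → a≢a refl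
  }

PAdj : ∀ {n} → Fin n → Fin n → Set
PAdj x y = (toℕ y ≡ suc (toℕ x)) ⊎ (toℕ x ≡ suc (toℕ y))

private
  n≢1+n : ∀ m → ¬ (m ≡ suc m)
  n≢1+n zero ()
  n≢1+n (suc m) eq = n≢1+n m (suc-inj eq)
    where
    suc-inj : ∀ {a b : ℕ} → suc a ≡ suc b → a ≡ b
    suc-inj refl = refl

P : ℕ → Graph
P n = record
  { V = Fin n
  ; Adj = PAdj
  ; symAdj = λ { (inj₁ e) → inj₂ e ; (inj₂ e) → inj₁ e }
  ; irrAdj = λ { {x} (inj₁ e) → n≢1+n (toℕ x) e ; {x} (inj₂ e) → n≢1+n (toℕ x) e }
  }

_□_ : Graph → Graph → Graph
G □ H = record
  { V = V G × V H
  ; Adj = λ { (g , h) (g' , h') → (g ≡ g' × Adj H h h') ⊎ (Adj G g g' × h ≡ h') }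
  ; symAdj = λ { (inj₁ (refl , a)) → inj₁ (refl , symAdj H a)
               ; (inj₂ (a , refl)) → inj₂ (symAdj G a , refl) }
  ; irrAdj = λ { (inj₁ (_ , a)) → irrAdj H a ; (inj₂ (a , _)) → irrAdj G a }
  }

module _ (G : Graph) where

  data Walk : V G → V G → Set where
    [] : ∀ {u} → Walk u u
    _∷_ : ∀ {u v w} → Adj G u v → Walk v w → Walk u w

  vertices : ∀ {u v} → Walk u v → List (V G)
  vertices {u} [] = u ∷ []
  vertices {u} (_ ∷ w) = u ∷ vertices w

  edges : ∀ {u v} → Walk u v → List (V G × V G)
  edges [] = []
  edges {u} (_∷_ {v = v} _ w) = (u , v) ∷ edges w

  IsPath : ∀ {u v} → Walk u v → Set
  IsPath w = AllPairs _≢_ (vertices w)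

  SameEdge : V G × V G → V G × V G → Set
  SameEdge (a , b) (c , d) = (a ≡ c × b ≡ d) ⊎ (a ≡ d × b ≡ c)

  EdgeDisjoint : ∀ {u v u' v'} → Walk u v → Walk u' v' → Set
  EdgeDisjoint p q = ∀ {e e'} → e ∈ edges p → e' ∈ edges q → ¬ SameEdge e e'

  record KImmersion (s : ℕ) : Set where
    field
      φ        : Fin s → V G
      φ-inj    : Injective _≡_ _≡_ φ
      route    : (i j : Fin s) → i <ᶠ j → Walk (φ i) (φ j)
      isPath   : ∀ i j (p : i <ᶠ j) → IsPath (route i j p)
      disjoint : ∀ i j k l (p : i <ᶠ j) (q : k <ᶠ l) →
                 ¬ (i ≡ k × j ≡ l) → EdgeDisjoint (route i j p) (route k l q)

  ImmersionNumberIs : ℕ → Set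
  ImmersionNumberIs m = KImmersion m × (∀ s → KImmersion s → s ≤ m)

module Submission where

-- Upper bound (for H □ P_n with H any graph on at most t vertices).  Take a
-- K_s-immersion.  If all branch vertices lie in one column, they lie in
-- distinct rows, so s ≤ t.  Otherwise some branch vertex x lies strictly left
-- of some branch vertex y; cut between column c = col x and column c + 1.
-- Only t edges cross this cut (one rung per row).  Every branch vertex z ≠ x
-- is separated by the cut from its partner (y if z is on the left of the cut,
-- x otherwise), the s - 1 routes from these vertices to their partners are
-- distinct, hence cross the cut in distinct edges: s - 1 ≤ t.
--
-- Lower bound (for K_t □ H with H any graph with an edge uv).  Put branch
-- vertex 0 at (0, v) and branch vertices 1..t at (0, u), …, (t-1, u).  Every
-- pair is joined by an edge, except 0 and a+2, which are joined through the
-- private vertex (a+1, v).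

open import Defs
open import Data.Nat using (ℕ; zero; suc; _≤_; _<_; _≤?_; z≤n; s≤s; s≤s⁻¹)
open import Data.Nat.Properties
  using (≤-antisym; ≤-refl; ≤-trans; n≤1+n; m≤n⇒m≤1+n; ≰⇒>; <⇒≱; <-cmp)
open import Data.Fin using (Fin; zero; suc; toℕ; punchIn) renaming (_<_ to _<ᶠ_)
open import Data.Fin.Properties
  using (toℕ-injective; injective⇒≤; punchIn-injective; punchInᵢ≢i; all?; ¬∀⟶∃¬)
  renaming (_≟_ to _≟ᶠ_; <-cmp to <ᶠ-cmp; <⇒≢ to <ᶠ⇒≢; <-asym to <ᶠ-asym)
open import Data.Product using (Σ; _×_; _,_; proj₁; proj₂)
open import Data.Sum using (_⊎_; inj₁; inj₂)
open import Data.Empty using (⊥; ⊥-elim)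
open import Data.List.Relation.Unary.Any using (here; there)
open import Data.List.Relation.Unary.All using ([]; _∷_)
open import Data.List.Relation.Unary.AllPairs using ([]; _∷_)
open import Data.List.Membership.Propositional using (_∈_)
open import Function using (_∘_)
open import Function.Definitions using (Injective)
open import Relation.Nullary using (¬_; yes; no; ¬?; decidable-stable)
open import Relation.Unary using (Decidable)
open import Relation.Binary using (tri<; tri≈; tri>)
open import Relation.Binary.PropositionalEquality
  using (_≡_; _≢_; refl; sym; trans; cong; cong₂; subst)

module _ {G : Graph} where

  sameEdge-join : ∀ {e e' d d'} → SameEdge G e d → SameEdge G e' d' → d ≡ d' →
                  SameEdge G e e'
  sameEdge-join (inj₁ (refl , refl)) (inj₁ (refl , refl)) refl = inj₁ (refl , refl)
  sameEdge-join (inj₁ (refl , refl)) (inj₂ (refl , refl)) refl = inj₂ (refl , refl)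
  sameEdge-join (inj₂ (refl , refl)) (inj₁ (refl , refl)) refl = inj₂ (refl , refl)
  sameEdge-join (inj₂ (refl , refl)) (inj₂ (refl , refl)) refl = inj₁ (refl , refl)

  sameEdge-sym : ∀ {e e'} → SameEdge G e e' → SameEdge G e' e
  sameEdge-sym (inj₁ (refl , refl)) = inj₁ (refl , refl)
  sameEdge-sym (inj₂ (refl , refl)) = inj₂ (refl , refl)

  record Crossing (L : V G → Set) {u v : V G} (w : Walk G u v) : Set where
    field
      tail head : V G
      adj       : Adj G tail head
      inside    : L tail
      outside   : ¬ L head
      edge      : V G × V G
      onWalk    : edge ∈ edges G w
      same      : SameEdge G edge (tail , head)

  exit : ∀ {L : V G → Set} {u v} → Decidable L → (w : Walk G u v) →
         L u → ¬ L v → Crossing L w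
  exit L? [] u-in v-out = ⊥-elim (v-out u-in)
  exit {u = u} L? (_∷_ {v = m} u~m w) u-in v-out with L? m
  ... | yes m-in = record
    { tail = tail ; head = head ; adj = adj ; inside = inside ; outside = outside
    ; edge = edge ; onWalk = there onWalk ; same = same }
    where open Crossing (exit L? w m-in v-out)
  ... | no m-out = record
    { tail = u ; head = m ; adj = u~m ; inside = u-in ; outside = m-out
    ; edge = (u , m) ; onWalk = here refl ; same = inj₁ (refl , refl) }

  Separated : (L : V G → Set) → V G → V G → Set
  Separated L u v = (L u × ¬ L v) ⊎ (¬ L u × L v)

  separated-sym : ∀ {L u v} → Separated L u v → Separated L v u
  separated-sym (inj₁ (a , b)) = inj₂ (b , a)
  separated-sym (inj₂ (a , b)) = inj₁ (b , a)

  -- A walk between the two sides of a decidable set L crosses it, in either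
  -- direction; a crossing out of the complement is a crossing of L reversed.
  cross : ∀ {L : V G → Set} {u v} → Decidable L → (w : Walk G u v) →
          Separated L u v → Crossing L w
  cross L? w (inj₁ (u-in , v-out)) = exit L? w u-in v-out
  cross L? w (inj₂ (u-out , v-in)) = record
    { tail = head ; head = tail ; adj = symAdj G adj
    ; inside = decidable-stable (L? head) outside ; outside = inside
    ; edge = edge ; onWalk = onWalk ; same = flip same }
    where
    open Crossing (exit (¬? ∘ L?) w u-out (λ ¬v-in → ¬v-in v-in))
    flip : ∀ {e a b} → SameEdge G e (a , b) → SameEdge G e (b , a)
    flip (inj₁ (refl , refl)) = inj₂ (refl , refl)
    flip (inj₂ (refl , refl)) = inj₁ (refl , refl)

  -- At most t edges leave L: the edges leaving L admit an injective labelling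
  -- by Fin t.
  record FewExits (L : V G → Set) (t : ℕ) : Set where
    field
      label     : V G → V G → Fin t
      label-inj : ∀ {a b a' b'} →
                  Adj G a b → L a → ¬ L b → Adj G a' b' → L a' → ¬ L b' →
                  label a b ≡ label a' b' → a ≡ a' × b ≡ b'

module _ {G : Graph} {s : ℕ} (I : KImmersion G s) where
  open KImmersion I

  record Link (i j : Fin s) : Set where
    field
      from to : Fin s
      ordered : from <ᶠ to
      ends    : (from ≡ i × to ≡ j) ⊎ (from ≡ j × to ≡ i)

  link : ∀ {i j} → i ≢ j → Link i j
  link {i} {j} i≢j with <ᶠ-cmp i j
  ... | tri< i<j _ _ = record { from = i ; to = j ; ordered = i<j ; ends = inj₁ (refl , refl) }
  ... | tri≈ _ i≡j _ = ⊥-elim (i≢j i≡j)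
  ... | tri> _ _ j<i = record { from = j ; to = i ; ordered = j<i ; ends = inj₂ (refl , refl) }

  shared-route : ∀ {i j k l} (p : i <ᶠ j) (q : k <ᶠ l) {e e'} →
                 e ∈ edges G (route i j p) → e' ∈ edges G (route k l q) →
                 SameEdge G e e' → i ≡ k × j ≡ l
  shared-route {i} {j} {k} {l} p q e∈ e'∈ e≈e' with i ≟ᶠ k | j ≟ᶠ l
  ... | yes i≡k | yes j≡l = i≡k , j≡l
  ... | no i≢k  | _       = ⊥-elim (disjoint i j k l p q (i≢k ∘ proj₁) e∈ e'∈ e≈e')
  ... | yes _   | no j≢l  = ⊥-elim (disjoint i j k l p q (j≢l ∘ proj₂) e∈ e'∈ e≈e')

module Cut {G : Graph} {s t : ℕ} (I : KImmersion G (suc s))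
           {L : V G → Set} (L? : Decidable L) (few : FewExits {G} L t)
           {x y : Fin (suc s)} (x-in : L (KImmersion.φ I x)) (y-out : ¬ L (KImmersion.φ I y)) where
  open KImmersion I
  open FewExits few

  partner : Fin (suc s) → Fin (suc s)
  partner z with L? (φ z)
  ... | yes _ = y
  ... | no _  = x

  partner-separated : ∀ z → Separated {G} L (φ z) (φ (partner z))
  partner-separated z with L? (φ z)
  ... | yes z-in  = inj₁ (z-in , y-out)
  ... | no z-out  = inj₂ (z-out , x-in)

  partner-≢ : ∀ z → z ≢ partner z
  partner-≢ z z≡p with partner-separated z
  ... | inj₁ (a , b) = b (subst (L ∘ φ) z≡p a)
  ... | inj₂ (a , b) = a (subst (L ∘ φ) (sym z≡p) b)

  partner-is-y : ∀ {z w} → z ≢ x → z ≡ partner w → z ≡ y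
  partner-is-y {w = w} z≢x z≡p with L? (φ w)
  ... | yes _ = z≡p
  ... | no _  = ⊥-elim (z≢x z≡p)

  pair : (z : Fin (suc s)) → Link I z (partner z)
  pair z = link I (partner-≢ z)

  pair-route : (z : Fin (suc s)) → Walk G (φ (Link.from (pair z))) (φ (Link.to (pair z)))
  pair-route z = route (Link.from (pair z)) (Link.to (pair z)) (Link.ordered (pair z))

  pair-crossing : (z : Fin (suc s)) → Crossing L (pair-route z)
  pair-crossing z = cross L? (pair-route z) (orient (Link.ends (pair z)))
    where
    orient : ∀ {f g} → (f ≡ z × g ≡ partner z) ⊎ (f ≡ partner z × g ≡ z) →
             Separated {G} L (φ f) (φ g)
    orient (inj₁ (refl , refl)) = partner-separated z
    orient (inj₂ (refl , refl)) = separated-sym {G} {L} (partner-separated z)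

  crossing-label : Fin (suc s) → Fin t
  crossing-label z = label tail head where open Crossing (pair-crossing z)

  -- Two vertices other than x whose links have the same ends are equal: either
  -- they are matched directly, or each equals the other's partner, hence y.
  links-agree : ∀ {z z' f g f' g'} → z ≢ x → z' ≢ x → f ≡ f' → g ≡ g' →
                (f ≡ z × g ≡ partner z) ⊎ (f ≡ partner z × g ≡ z) →
                (f' ≡ z' × g' ≡ partner z') ⊎ (f' ≡ partner z' × g' ≡ z') → z ≡ z'
  links-agree _ _ refl refl (inj₁ (a , _)) (inj₁ (a' , _)) = trans (sym a) a'
  links-agree _ _ refl refl (inj₂ (_ , b)) (inj₂ (_ , b')) = trans (sym b) b'
  links-agree z≢x z'≢x refl refl (inj₁ (a , b)) (inj₂ (a' , b')) =
    trans (partner-is-y z≢x (trans (sym a) a')) (sym (partner-is-y z'≢x (trans (sym b') b)))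
  links-agree z≢x z'≢x refl refl (inj₂ (a , b)) (inj₁ (a' , b')) =
    trans (partner-is-y z≢x (trans (sym b) b')) (sym (partner-is-y z'≢x (trans (sym a') a)))

  crossing-label-injective : ∀ {z z'} → z ≢ x → z' ≢ x →
                             crossing-label z ≡ crossing-label z' → z ≡ z'
  crossing-label-injective {z} {z'} z≢x z'≢x eq =
    links-agree z≢x z'≢x (proj₁ routes) (proj₂ routes) (Link.ends (pair z)) (Link.ends (pair z'))
    where
    module C = Crossing (pair-crossing z)
    module C' = Crossing (pair-crossing z')
    same-exit : C.tail ≡ C'.tail × C.head ≡ C'.head
    same-exit = label-inj C.adj C.inside C.outside C'.adj C'.inside C'.outside eq
    routes : Link.from (pair z) ≡ Link.from (pair z') × Link.to (pair z) ≡ Link.to (pair z')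
    routes = shared-route I (Link.ordered (pair z)) (Link.ordered (pair z')) C.onWalk C'.onWalk
               (sameEdge-join {G} C.same C'.same (cong₂ _,_ (proj₁ same-exit) (proj₂ same-exit)))

  bound : s ≤ t
  bound = injective⇒≤ {f = crossing-label ∘ punchIn x}
            (punchIn-injective x _ _ ∘ crossing-label-injective (punchInᵢ≢i x _) (punchInᵢ≢i x _))

-- H □ P_n for a graph H with at most t vertices, witnessed by an injective
-- row code into Fin t.
module Ladder (H : Graph) (n : ℕ) {t : ℕ}
              (code : V H → Fin t) (code-inj : Injective _≡_ _≡_ code) where

  col : V (H □ P n) → ℕ
  col (_ , h) = toℕ h

  LeftOf : ℕ → V (H □ P n) → Set
  LeftOf c v = col v ≤ c

  leaving-is-rung : ∀ {c g h g' h'} → Adj (H □ P n) (g , h) (g' , h') →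
                    toℕ h ≤ c → ¬ toℕ h' ≤ c → g ≡ g' × toℕ h ≡ c × toℕ h' ≡ suc c
  leaving-is-rung {c} {h = h} (inj₁ (g≡g' , inj₁ h'≡1+h)) h≤c h'≰c =
    g≡g' , h≡c , trans h'≡1+h (cong suc h≡c)
    where
    h≡c : toℕ h ≡ c
    h≡c = ≤-antisym h≤c (s≤s⁻¹ (subst (suc c ≤_) h'≡1+h (≰⇒> h'≰c)))
  leaving-is-rung {h' = h'} (inj₁ (_ , inj₂ h≡1+h')) h≤c h'≰c =
    ⊥-elim (h'≰c (≤-trans (n≤1+n (toℕ h')) (subst (_≤ _) h≡1+h' h≤c)))
  leaving-is-rung (inj₂ (_ , refl)) h≤c h'≰c = ⊥-elim (h'≰c h≤c)

  -- Each column cut is crossed by at most t edges: the row of a leaving edge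
  -- determines it.
  column-cut : (c : ℕ) → FewExits {H □ P n} (LeftOf c) t
  column-cut c = record { label = λ a _ → code (proj₁ a) ; label-inj = rung-determined }
    where
    rung-determined : ∀ {a b a' b'} →
                      Adj (H □ P n) a b → LeftOf c a → ¬ LeftOf c b →
                      Adj (H □ P n) a' b' → LeftOf c a' → ¬ LeftOf c b' →
                      code (proj₁ a) ≡ code (proj₁ a') → a ≡ a' × b ≡ b'
    rung-determined {g , _} {_ , _} {g' , _} {_ , _} ab a-in b-out ab' a'-in b'-out same-code
      with leaving-is-rung ab a-in b-out | leaving-is-rung ab' a'-in b'-out
    ... | refl , h≡c , k≡c | refl , h'≡c , k'≡c =
      cong₂ _,_ rows (toℕ-injective (trans h≡c (sym h'≡c))) ,
      cong₂ _,_ rows (toℕ-injective (trans k≡c (sym k'≡c)))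
      where
      rows : g ≡ g'
      rows = code-inj same-code

  module _ {s : ℕ} (I : KImmersion (H □ P n) s) where
    open KImmersion I

    one-column-bound : ∀ {h} → (∀ z → proj₂ (φ z) ≡ h) → s ≤ t
    one-column-bound one-col =
      injective⇒≤ {f = code ∘ proj₁ ∘ φ}
        (λ same-code → φ-inj (cong₂ _,_ (code-inj same-code) (trans (one-col _) (sym (one-col _)))))

  module _ {s : ℕ} (I : KImmersion (H □ P n) (suc s)) where
    open KImmersion I

    column-spread : (∀ z → proj₂ (φ z) ≡ proj₂ (φ zero)) ⊎
                    Σ (Fin (suc s)) λ x → Σ (Fin (suc s)) λ y → col (φ x) < col (φ y)
    column-spread with all? (λ z → proj₂ (φ z) ≟ᶠ proj₂ (φ zero))
    ... | yes one-col = inj₁ one-col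
    ... | no ¬one-col with ¬∀⟶∃¬ _ _ (λ z → proj₂ (φ z) ≟ᶠ proj₂ (φ zero)) ¬one-col
    ...   | y , y-elsewhere with <-cmp (col (φ zero)) (col (φ y))
    ...     | tri< left _ _  = inj₂ (zero , y , left)
    ...     | tri≈ _ same _  = ⊥-elim (y-elsewhere (toℕ-injective (sym same)))
    ...     | tri> _ _ right = inj₂ (y , zero , right)

    two-column-bound : ∀ {x y} → col (φ x) < col (φ y) → s ≤ t
    two-column-bound {x} x<y =
      Cut.bound I (λ v → col v ≤? col (φ x)) (column-cut (col (φ x))) ≤-refl (<⇒≱ x<y)

  immersion-bound : ∀ {s} → KImmersion (H □ P n) s → s ≤ suc t
  immersion-bound {zero} I = z≤n
  immersion-bound {suc s} I with column-spread I
  ... | inj₁ one-col          = m≤n⇒m≤1+n (one-column-bound I one-col)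
  ... | inj₂ (_ , _ , x<y)    = s≤s (two-column-bound I x<y)

module _ {G : Graph} where

  data ShortRoute (u v : V G) : Set where
    direct : Adj G u v → ShortRoute u v
    via    : (m : V G) → Adj G u m → Adj G m v → ShortRoute u v

  short-walk : ∀ {u v} → ShortRoute u v → Walk G u v
  short-walk (direct u~v)      = u~v ∷ []
  short-walk (via m u~m m~v)   = u~m ∷ (m~v ∷ [])

  Interior : ∀ {u v} → V G → ShortRoute u v → Set
  Interior x (direct _)    = ⊥
  Interior x (via m _ _)   = x ≡ m

  EndOf : V G → V G × V G → Set
  EndOf x (a , b) = x ≡ a ⊎ x ≡ b

  end-of-same : ∀ {x e e'} → SameEdge G e e' → EndOf x e → EndOf x e'
  end-of-same (inj₁ (refl , refl)) x-end = x-end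
  end-of-same (inj₂ (refl , refl)) (inj₁ x≡a) = inj₂ x≡a
  end-of-same (inj₂ (refl , refl)) (inj₂ x≡b) = inj₁ x≡b

  short-edge : ∀ {u v e} (r : ShortRoute u v) → e ∈ edges G (short-walk r) →
               e ≡ (u , v) ⊎ Σ (V G) λ x → Interior x r × EndOf x e
  short-edge (direct _) (here e≡uv) = inj₁ e≡uv
  short-edge (via m _ _) (here refl) = inj₂ (m , refl , inj₂ refl)
  short-edge (via m _ _) (there (here refl)) = inj₂ (m , refl , inj₁ refl)

  short-end : ∀ {u v e x} (r : ShortRoute u v) → e ∈ edges G (short-walk r) →
              EndOf x e → x ≡ u ⊎ x ≡ v ⊎ Interior x r
  short-end (direct _) (here refl) (inj₁ x≡u) = inj₁ x≡u
  short-end (direct _) (here refl) (inj₂ x≡v) = inj₂ (inj₁ x≡v)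
  short-end (via _ _ _) (here refl) (inj₁ x≡u) = inj₁ x≡u
  short-end (via _ _ _) (here refl) (inj₂ x≡m) = inj₂ (inj₂ x≡m)
  short-end (via _ _ _) (there (here refl)) (inj₁ x≡m) = inj₂ (inj₂ x≡m)
  short-end (via _ _ _) (there (here refl)) (inj₂ x≡v) = inj₂ (inj₁ x≡v)

  record ShortModel (s : ℕ) : Set where
    field
      φ          : Fin s → V G
      φ-inj      : Injective _≡_ _≡_ φ
      join       : (i j : Fin s) → i <ᶠ j → ShortRoute (φ i) (φ j)
      not-branch : ∀ {i j p x} → Interior x (join i j p) → ∀ k → x ≢ φ k
      private-interior : ∀ {i j k l p q x} →
                         Interior x (join i j p) → Interior x (join k l q) → i ≡ k × j ≡ l

  short-model⇒immersion : ∀ {s} → ShortModel s → KImmersion G s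
  short-model⇒immersion M = record
    { φ = φ ; φ-inj = φ-inj ; route = λ i j p → short-walk (join i j p)
    ; isPath = is-path ; disjoint = edge-disjoint }
    where
    open ShortModel M

    branch-≢ : ∀ {i j} → i <ᶠ j → φ i ≢ φ j
    branch-≢ i<j = <ᶠ⇒≢ i<j ∘ φ-inj

    is-path : ∀ i j (p : i <ᶠ j) → IsPath G (short-walk (join i j p))
    is-path i j p with join i j p | not-branch {i} {j} {p}
    ... | direct _    | _     = (branch-≢ p ∷ []) ∷ ([] ∷ [])
    ... | via m _ _   | m∉φ =
      ((λ i≡m → m∉φ refl i (sym i≡m)) ∷ (branch-≢ p ∷ [])) ∷ ((m∉φ refl j ∷ []) ∷ ([] ∷ []))

    same-direct : ∀ {i j k l} → i <ᶠ j → k <ᶠ l → SameEdge G (φ i , φ j) (φ k , φ l) →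
                  i ≡ k × j ≡ l
    same-direct _ _ (inj₁ (i≡k , j≡l)) = φ-inj i≡k , φ-inj j≡l
    same-direct i<j k<l (inj₂ (i≡l , j≡k))
      rewrite φ-inj i≡l | φ-inj j≡k = ⊥-elim (<ᶠ-asym i<j k<l)

    edge-disjoint : ∀ i j k l (p : i <ᶠ j) (q : k <ᶠ l) → ¬ (i ≡ k × j ≡ l) →
                    EdgeDisjoint G (short-walk (join i j p)) (short-walk (join k l q))
    edge-disjoint i j k l p q different e∈ e'∈ e≈e'
      with short-edge (join i j p) e∈ | short-edge (join k l q) e'∈
    ... | inj₂ (x , x-int , x-end) | _
      with short-end (join k l q) e'∈ (end-of-same e≈e' x-end)
    ...   | inj₁ x≡φk = not-branch x-int k x≡φk
    ...   | inj₂ (inj₁ x≡φl) = not-branch x-int l x≡φl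
    ...   | inj₂ (inj₂ x-int') = different (private-interior x-int x-int')
    edge-disjoint i j k l p q different e∈ e'∈ e≈e'
        | inj₁ refl | inj₁ refl = different (same-direct p q e≈e')
    edge-disjoint i j k l p q different e∈ e'∈ e≈e'
        | inj₁ refl | inj₂ (x , x-int , x-end)
      with end-of-same (sameEdge-sym {G} e≈e') x-end
    ...   | inj₁ x≡φi = not-branch x-int i x≡φi
    ...   | inj₂ x≡φj = not-branch x-int j x≡φj

-- K_{t+1} □ H has a K_{t+2}-immersion whenever H has an edge uv: branch vertex
-- 0 sits at (0, v), branch vertex a+1 at (a, u); the pair 0, a+2 is joined
-- through the private vertex (a+1, v), every other pair by an edge.
module Prism (t : ℕ) (H : Graph) {u v : V H} (uv : Adj H u v) where

  G : Graph
  G = K (suc t) □ H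

  u≢v : u ≢ v
  u≢v refl = irrAdj H uv

  branch : Fin (suc (suc t)) → V G
  branch zero    = (zero , v)
  branch (suc a) = (a , u)

  branch-inj : Injective _≡_ _≡_ branch
  branch-inj {zero}  {zero}  _  = refl
  branch-inj {zero}  {suc _} eq = ⊥-elim (u≢v (sym (cong proj₂ eq)))
  branch-inj {suc _} {zero}  eq = ⊥-elim (u≢v (cong proj₂ eq))
  branch-inj {suc _} {suc _} eq = cong suc (cong proj₁ eq)

  join : (i j : Fin (suc (suc t))) → i <ᶠ j → ShortRoute {G} (branch i) (branch j)
  join zero    (suc zero)    _         = direct (inj₁ (refl , symAdj H uv))
  join zero    (suc (suc a)) _         = via (suc a , v) (inj₂ ((λ ()) , refl)) (inj₁ (refl , symAdj H uv))
  join (suc a) (suc b)       (s≤s a<b) = direct (inj₂ (<ᶠ⇒≢ a<b , refl))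

  -- The interior vertex (a+1, v) is in a row other than 0 and a column other than u.
  not-branch : ∀ {i j p x} → Interior x (join i j p) → ∀ k → x ≢ branch k
  not-branch {zero} {suc (suc a)} refl zero    ()
  not-branch {zero} {suc (suc a)} refl (suc k) eq = u≢v (sym (cong proj₂ eq))
  not-branch {suc _} {suc _} {s≤s _} ()

  -- Its row a+1 determines the pair 0, a+2.
  private-interior : ∀ {i j k l p q x} → Interior x (join i j p) → Interior x (join k l q) →
                     i ≡ k × j ≡ l
  private-interior {zero} {suc (suc a)} {zero} {suc (suc b)} refl eq =
    refl , cong suc (cong proj₁ eq)
  private-interior {zero} {suc (suc _)} {zero} {suc zero} _ ()
  private-interior {zero} {suc (suc _)} {suc _} {suc _} {q = s≤s _} _ ()
  private-interior {suc _} {suc _} {p = s≤s _} ()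

  model : ShortModel {G} (suc (suc t))
  model = record
    { φ = branch ; φ-inj = branch-inj ; join = join
    ; not-branch = not-branch ; private-interior = private-interior }

  immersion : KImmersion G (suc (suc t))
  immersion = short-model⇒immersion model

first-edge : ∀ n → Adj (P (suc (suc n))) zero (suc zero)
first-edge n = inj₁ refl

theorem12 : (t n : ℕ) → 1 ≤ t → 2 ≤ n → ImmersionNumberIs (K t □ P n) (suc t)
theorem12 (suc t) (suc (suc n)) _ _ =
  Prism.immersion t (P (suc (suc n))) (first-edge n) ,
  λ s → Ladder.immersion-bound (K (suc t)) (suc (suc n)) (λ a → a) (λ eq → eq)
theorem12 (suc t) (suc zero) _ (s≤s ())
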